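{- Let $S\subseteq\mathbb{Z}^+$ and integers $n,r\ge0$. Then $$\mathcal{D}_{n, S, r}=\frac{r!}{2^{r+1}}\sum_{\ell=0}^\infty \frac{1}{2^\ell}\binom{r+\ell}{\ell}\sum_{k=0}^n L_{S,r}(n,k)\,(\ell)_k.$$
   Context: $L_{S,r}(n,k)$ is the number of partitions of $[n+r]$ into $k+r$ non-empty lists (linearly ordered blocks; the set of lists is unordered) with every list of size in $S$ and $1,\dots,r$ in distinct lists. $\mathcal{D}_{n,S,r}$ is the number of sequences (ordered tuples) of non-empty lists with pairwise disjoint label sets covering $[n+r]$, each of size in $S$, with $1,\dots,r$ in distinct lists. $(\ell)_k=\ell(\ell-1)\cdots(\ell-k+1)$, $(\ell)_0=1$. -}

module Defs where

open import Data.Bool using (Bool; true; false; _∧_; not; T)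
open import Data.Nat as ℕ using (ℕ; _!; zero; suc; _+_; _*_; _∸_; _^_; _⊓_; _<ᵇ_; _≡ᵇ_; _≤_)
open import Data.Nat.Properties using (m^n≢0)
open import Data.Nat.Combinatorics using (_C_)
open import Data.Fin using (Fin; toℕ)
open import Data.List using (List; []; _∷_; length; map; concat; foldr; allFin; null)
open import Data.Product using (Σ; ∃; _×_)
open import Data.Integer using (+_)
open import Data.Rational as ℚ using (ℚ; _/_; ∣_∣; _-_; _<_)

falling : ℕ → ℕ → ℕ
falling ℓ zero = 1
falling ℓ (suc k) = falling ℓ k * (ℓ ∸ k)

all : ∀ {A : Set} → (A → Bool) → List A → Bool
all p [] = true
all p (x ∷ xs) = p x ∧ all p xs

sumℕ : ℕ → (ℕ → ℕ) → ℕ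
sumℕ zero f = 0
sumℕ (suc m) f = sumℕ m f + f m

sumℚ : ℕ → (ℕ → ℚ) → ℚ
sumℚ zero f = ℚ.0ℚ
sumℚ (suc m) f = sumℚ m f ℚ.+ f m

-- Boolean-valued conditions on a family of lists of labels in Fin N.
-- (Boolean so that the resulting subtypes have propositional witnesses.)

occ : ∀ {N} → Fin N → List (Fin N) → ℕ
occ x [] = 0
occ x (y ∷ ys) with toℕ x ≡ᵇ toℕ y
... | true  = suc (occ x ys)
... | false = occ x ys

coversOnce : ∀ {N} → List (List (Fin N)) → Bool
coversOnce {N} bs = all (λ x → occ x (concat bs) ≡ᵇ 1) (allFin N)

allNonEmpty : ∀ {N} → List (List (Fin N)) → Bool
allNonEmpty bs = all (λ b → not (null b)) bs

sizesIn : ∀ {N} → (ℕ → Bool) → List (List (Fin N)) → Bool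
sizesIn S bs = all (λ b → S (length b)) bs

-- number of special labels (labels 1..r, i.e. Fin-values 0..r-1) in a list
specials : ∀ {N} → ℕ → List (Fin N) → ℕ
specials r [] = 0
specials r (x ∷ xs) with toℕ x <ᵇ r
... | true  = suc (specials r xs)
... | false = specials r xs

specialsSeparated : ∀ {N} → ℕ → List (List (Fin N)) → Bool
specialsSeparated r bs = all (λ b → specials r b <ᵇ 2) bs

minLabel : ∀ {N} → List (Fin N) → ℕ
minLabel {N} b = foldr _⊓_ N (map toℕ b)

strictlyIncreasing : List ℕ → Bool
strictlyIncreasing [] = true
strictlyIncreasing (x ∷ []) = true
strictlyIncreasing (x ∷ y ∷ ys) = (x <ᵇ y) ∧ strictlyIncreasing (y ∷ ys)

validSeq : ∀ {N} → (ℕ → Bool) → ℕ → List (List (Fin N)) → Bool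
validSeq S r bs = coversOnce bs ∧ allNonEmpty bs ∧ sizesIn S bs ∧ specialsSeparated r bs

DStruct : (ℕ → Bool) → (n r : ℕ) → Set
DStruct S n r = Σ (List (List (Fin (n + r)))) (λ bs → T (validSeq S r bs))

-- L_{S,r}(n,k)-structures: SETS of k + r lists.  A set of lists is
-- represented canonically by listing its blocks in increasing order of
-- their minimal labels (blocks are disjoint, so minima are distinct).
LStruct : (ℕ → Bool) → (n r k : ℕ) → Set
LStruct S n r k =
  Σ (List (List (Fin (n + r))))
    (λ bs → T (validSeq S r bs ∧ (length bs ≡ᵇ k + r) ∧ strictlyIncreasing (map minLabel bs)))

-- the ℓ-th summand, already multiplied by the prefactor r!/2^{r+1}:
--   r! C(r+ℓ,ℓ) (Σ_{k=0}^n L(k) (ℓ)_k) / 2^{r+1+ℓ}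
summand : (n r : ℕ) → (ℕ → ℕ) → ℕ → ℚ
summand n r L ℓ =
  _/_ (+ ((r !) * ((r + ℓ) C ℓ) * sumℕ (suc n) (λ k → L k * falling ℓ k)))
      (2 ^ (suc r + ℓ)) {{m^n≢0 2 (suc r + ℓ)}}

ConvergesTo : (ℕ → ℚ) → ℚ → Set
ConvergesTo f q = ∀ (ε : ℚ) → ℚ.0ℚ < ε → ∃ λ N → ∀ M → N ≤ M → ∣ f M - q ∣ < ε

{-# OPTIONS --safe #-}
module Submission where

-- An ordered sequence of k + r lists is a set of such lists together with an ordering of it, so
-- 𝒟 = Σ_k L(k) (r + k)!; a sequence is encoded by its set of lists, sorted by minimal labels, and an
-- insertion code. On the analytic side r! C(r + ℓ, ℓ) (ℓ)_k = (r + k)! C(r + ℓ, r + k), and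
-- Σ_ℓ C(r + ℓ, j) / 2 ^ (r + ℓ + 1) = 1 for j = r + k: multiplied by 2 ^ (r + M), the partial sum falls short
-- of 2 ^ (r + M) by Σ_{i≤j} C(r + M, i), a polynomial in M, which is negligible against 2 ^ (r + M).

open import Defs
open import Data.Bool using (Bool; true; false; T; not; _∧_; if_then_else_)
open import Data.Bool.Properties using (∧-assoc; ∧-comm; T-∧; T-irrelevant)
open import Data.Empty using (⊥-elim)
open import Data.Unit using (⊤; tt)
open import Data.Product using (Σ; ∃; _×_; _,_; proj₁; proj₂; uncurry)
open import Data.Product.Properties using (Σ-≡,≡→≡)
open import Data.Sum using (_⊎_; inj₁; inj₂)
open import Relation.Binary.PropositionalEquality
open import Relation.Nullary.Reflects using (ofʸ; ofⁿ)

open import Data.Nat hiding (_/_)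
open import Data.Nat.Properties
open import Data.Nat.Combinatorics using (_C_; nCk+nC[k+1]≡[n+1]C[k+1]; k>n⇒nCk≡0; nCk≡n!/k![n-k]!; k![n∸k]!∣n!)
import Data.Nat.DivMod as DivMod
open import Data.Nat.Solver using (module +-*-Solver)
open +-*-Solver using (solve; _:+_; _:*_; _:=_; con)
import Data.Integer as ℤ
open ℤ using (+_; +<+)
import Data.Integer.Properties as ℤ
import Data.Integer.Solver as ℤ-Solver
import Data.Rational as ℚ
open ℚ using (ℚ; mkℚ; _/_; toℚᵘ)
import Data.Rational.Properties as ℚ
import Data.Rational.Unnormalised as ℚᵘ
open ℚᵘ using (mkℚᵘ; *≡*; *<*)
import Data.Rational.Unnormalised.Properties as ℚᵘ

open import Data.Fin using (Fin; zero; suc; toℕ; fromℕ<)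
open import Data.Fin.Properties using (*↔×; +↔⊎; toℕ-fromℕ<; toℕ-injective; toℕ<n)
open import Data.Fin.Permutation using (↔⇒≡)
open import Data.List using (List; []; _∷_; _++_; concat; null; allFin)
import Data.List as List
open import Data.List.Membership.Propositional using (_∈_)
open import Data.List.Membership.Propositional.Properties using (∈-allFin)
open import Data.List.Relation.Unary.Any using (here; there)
open import Data.List.Relation.Binary.Permutation.Propositional as ↭ using (_↭_; ↭-refl; ↭-trans; prep; swap)
open import Data.Vec using (Vec; []; _∷_; lookup; insertAt; removeAt; toList)
open import Data.Vec.Properties using (insertAt-removeAt; removeAt-insertAt; insertAt-lookup; length-toList)
open import Data.Vec.Relation.Unary.All as All using (All; []; _∷_)
open import Data.Vec.Relation.Unary.AllPairs using (AllPairs; []; _∷_)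

open import Function.Bundles using (_↔_; mk↔ₛ′; Equivalence)
open import Function.Properties.Inverse using (↔-refl; ↔-sym; ↔-trans)
open import Function.Related.Propositional using (module EquationalReasoning)
open import Data.Product.Function.NonDependent.Propositional using (_×-↔_)
open import Data.Product.Function.Dependent.Propositional using (Σ-↔)
open import Data.Sum.Function.Propositional using (_⊎-↔_)

T-∧⁻ : ∀ {a b} → T (a ∧ b) → T a × T b
T-∧⁻ = Equivalence.to T-∧

T-∧⁺ : ∀ {a b} → T a → T b → T (a ∧ b)
T-∧⁺ ta tb = Equivalence.from T-∧ (ta , tb)

sumℕ-cong : ∀ m {f g : ℕ → ℕ} → (∀ k → f k ≡ g k) → sumℕ m f ≡ sumℕ m g
sumℕ-cong zero    f≗g = refl
sumℕ-cong (suc m) f≗g = cong₂ _+_ (sumℕ-cong m f≗g) (f≗g m)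

sumℕ-zero : ∀ m → sumℕ m (λ _ → 0) ≡ 0
sumℕ-zero zero    = refl
sumℕ-zero (suc m) = cong (_+ 0) (sumℕ-zero m)

*-distribˡ-sumℕ : ∀ m a f → a * sumℕ m f ≡ sumℕ m (λ k → a * f k)
*-distribˡ-sumℕ zero    a f = *-zeroʳ a
*-distribˡ-sumℕ (suc m) a f =
  trans (*-distribˡ-+ a (sumℕ m f) (f m)) (cong (_+ a * f m) (*-distribˡ-sumℕ m a f))

sumℕ-+ : ∀ m f g → sumℕ m (λ k → f k + g k) ≡ sumℕ m f + sumℕ m g
sumℕ-+ zero    f g = refl
sumℕ-+ (suc m) f g = trans (cong (_+ (f m + g m)) (sumℕ-+ m f g))
  (solve 4 (λ a b c d → (a :+ b) :+ (c :+ d) := (a :+ c) :+ (b :+ d)) refl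
     (sumℕ m f) (sumℕ m g) (f m) (g m))

sumℕ-mono-≤ : ∀ m {f g : ℕ → ℕ} → (∀ k → k < m → f k ≤ g k) → sumℕ m f ≤ sumℕ m g
sumℕ-mono-≤ zero    f≤g = ≤-refl
sumℕ-mono-≤ (suc m) f≤g =
  +-mono-≤ (sumℕ-mono-≤ m (λ k k<m → f≤g k (m<n⇒m<1+n k<m))) (f≤g m ≤-refl)

sumℕ-monoˡ-≤ : ∀ f {m m′} → m ≤ m′ → sumℕ m f ≤ sumℕ m′ f
sumℕ-monoˡ-≤ f {m′ = zero}   z≤n = ≤-refl
sumℕ-monoˡ-≤ f {m′ = suc m′} m≤1+m′ with m≤n⇒m<n∨m≡n m≤1+m′
... | inj₁ (s≤s m≤m′) = ≤-trans (sumℕ-monoˡ-≤ f m≤m′) (m≤m+n _ _)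
... | inj₂ refl       = ≤-refl

binomSum : ℕ → ℕ → ℕ
binomSum j t = sumℕ j (t C_)

binomSum-pascal : ∀ j t → binomSum (suc j) (suc t) ≡ binomSum (suc j) t + binomSum j t
binomSum-pascal zero    t = refl
binomSum-pascal (suc j) t = begin
  binomSum (suc j) (suc t) + suc t C suc j
    ≡⟨ cong₂ _+_ (binomSum-pascal j t) (sym (nCk+nC[k+1]≡[n+1]C[k+1] t j)) ⟩
  (binomSum (suc j) t + binomSum j t) + (t C j + t C suc j)
    ≡⟨ solve 4 (λ a b c d → (a :+ b) :+ (c :+ d) := (a :+ d) :+ (b :+ c)) refl
         (binomSum (suc j) t) (binomSum j t) (t C j) (t C suc j) ⟩
  (binomSum (suc j) t + t C suc j) + (binomSum j t + t C j) ∎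
  where open ≡-Reasoning

binomSum-zero : ∀ j → binomSum (suc j) 0 ≡ 1
binomSum-zero zero    = refl
binomSum-zero (suc j) = cong (_+ 0) (binomSum-zero j)

binomSum-suc-≤ : ∀ j t → binomSum j (suc t) ≤ 2 * binomSum j t
binomSum-suc-≤ zero    t = z≤n
binomSum-suc-≤ (suc j) t = begin
  binomSum (suc j) (suc t)          ≡⟨ binomSum-pascal j t ⟩
  binomSum (suc j) t + binomSum j t ≤⟨ +-monoʳ-≤ (binomSum (suc j) t) (sumℕ-monoˡ-≤ (t C_) (n≤1+n j)) ⟩
  binomSum (suc j) t + binomSum (suc j) t ≡⟨ cong (_+_ (binomSum (suc j) t)) (+-identityʳ _) ⟨
  2 * binomSum (suc j) t            ∎
  where open ≤-Reasoning

binomSum-≤-^ : ∀ j t → binomSum (suc j) t ≤ suc t ^ j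
binomSum-≤-^ j       zero    = ≤-reflexive (trans (binomSum-zero j) (sym (^-zeroˡ j)))
binomSum-≤-^ zero    (suc t) = ≤-refl
binomSum-≤-^ (suc j) (suc t) = begin
  binomSum (suc (suc j)) (suc t)              ≡⟨ binomSum-pascal (suc j) t ⟩
  binomSum (suc (suc j)) t + binomSum (suc j) t ≤⟨ +-mono-≤ (binomSum-≤-^ (suc j) t) (binomSum-≤-^ j t) ⟩
  suc t ^ suc j + suc t ^ j                   ≡⟨ +-comm (suc t ^ suc j) _ ⟩
  suc (suc t) * suc t ^ j                     ≤⟨ *-monoʳ-≤ (2 + t) (^-monoˡ-≤ j (n≤1+n (suc t))) ⟩
  suc (suc t) ^ suc j                         ∎
  where open ≤-Reasoning

-- 2 ^ t · Σ_{m<t} C(m,j) / 2 ^ (m + 1)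
scaledBinomSeries : ℕ → ℕ → ℕ
scaledBinomSeries j zero    = 0
scaledBinomSeries j (suc t) = 2 * scaledBinomSeries j t + t C j

-- In other words Σ_{m<t} C(m,j) / 2 ^ (m + 1) = 1 − Σ_{i≤j} C(t,i) / 2 ^ t, whence Σ_m C(m,j) / 2 ^ (m + 1) = 1.
scaledBinomSeries-+-binomSum : ∀ j t → scaledBinomSeries j t + binomSum (suc j) t ≡ 2 ^ t
scaledBinomSeries-+-binomSum j zero    = binomSum-zero j
scaledBinomSeries-+-binomSum j (suc t) = begin
  (2 * a + t C j) + binomSum (suc j) (suc t)
    ≡⟨ cong (_+_ (2 * a + t C j)) (binomSum-pascal j t) ⟩
  (2 * a + t C j) + ((binomSum j t + t C j) + binomSum j t)
    ≡⟨ solve 3 (λ a c b → (con 2 :* a :+ c) :+ ((b :+ c) :+ b) := con 2 :* (a :+ (b :+ c))) refl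
         a (t C j) (binomSum j t) ⟩
  2 * (a + binomSum (suc j) t)
    ≡⟨ cong (2 *_) (scaledBinomSeries-+-binomSum j t) ⟩
  2 ^ suc t ∎
  where
  open ≡-Reasoning
  a = scaledBinomSeries j t

scaledBinomSeries-vanishes : ∀ j t → t ≤ j → scaledBinomSeries j t ≡ 0
scaledBinomSeries-vanishes j zero    _   = refl
scaledBinomSeries-vanishes j (suc t) t<j
  rewrite scaledBinomSeries-vanishes j t (<⇒≤ t<j) | k>n⇒nCk≡0 {t} {j} t<j = refl

sub-doubling⇒ratio-antitone : (g : ℕ → ℕ) → (∀ t → g (suc t) ≤ 2 * g t) →
                               ∀ {s t} → s ≤ t → g t * 2 ^ s ≤ g s * 2 ^ t
sub-doubling⇒ratio-antitone g g≤2g {s} {t} s≤t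
  rewrite sym (m∸n+n≡m s≤t) = go (t ∸ s)
  where
  open ≤-Reasoning
  go : ∀ d → g (d + s) * 2 ^ s ≤ g s * 2 ^ (d + s)
  go zero    = ≤-refl
  go (suc d) = begin
    g (suc (d + s)) * 2 ^ s   ≤⟨ *-monoˡ-≤ (2 ^ s) (g≤2g (d + s)) ⟩
    2 * g (d + s) * 2 ^ s     ≡⟨ *-assoc 2 (g (d + s)) (2 ^ s) ⟩
    2 * (g (d + s) * 2 ^ s)   ≤⟨ *-monoʳ-≤ 2 (go d) ⟩
    2 * (g s * 2 ^ (d + s))   ≡⟨ solve 3 (λ a b c → a :* (b :* c) := b :* (a :* c)) refl 2 (g s) (2 ^ (d + s)) ⟩
    g s * 2 ^ suc (d + s)     ∎

n<2^n : ∀ n → n < 2 ^ n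
n<2^n zero    = s≤s z≤n
n<2^n (suc n) = begin-strict
  suc n          <⟨ s≤s (n<2^n n) ⟩
  1 + 2 ^ n      ≤⟨ +-monoˡ-≤ (2 ^ n) (m^n>0 2 n) ⟩
  2 ^ n + 2 ^ n  ≡⟨ cong (_+_ (2 ^ n)) (+-identityʳ (2 ^ n)) ⟨
  2 ^ suc n      ∎
  where open ≤-Reasoning

-- The witness is t = 2 ^ s with s = 2 (K + 2 J + 1): then K (1 + t) ^ J ≤ K 2 ^ ((s + 1) J) < 2 ^ (K + (s + 1) J) ≤ 2 ^ t.
polynomial<exponential : ∀ K J → ∃ λ t → K * suc t ^ J < 2 ^ t
polynomial<exponential K J = 2 ^ s , (begin-strict
  K * suc (2 ^ s) ^ J            ≤⟨ *-monoʳ-≤ K (^-monoˡ-≤ J 1+2^s≤2^[1+s]) ⟩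
  K * (2 ^ suc s) ^ J            ≡⟨ cong (K *_) (^-*-assoc 2 (suc s) J) ⟩
  K * 2 ^ (suc s * J)            <⟨ *-monoˡ-< (2 ^ (suc s * J)) {{m^n≢0 2 (suc s * J)}} (n<2^n K) ⟩
  2 ^ K * 2 ^ (suc s * J)        ≡⟨ ^-distribˡ-+-* 2 K (suc s * J) ⟨
  2 ^ (K + suc s * J)            ≤⟨ ^-monoʳ-≤ 2 exponent≤ ⟩
  2 ^ 2 ^ s                      ∎)
  where
  open ≤-Reasoning
  u = suc (K + 2 * J)
  s = u + u
  1+2^s≤2^[1+s] : suc (2 ^ s) ≤ 2 ^ suc s
  1+2^s≤2^[1+s] = ≤-trans (+-monoˡ-≤ (2 ^ s) (m^n>0 2 s)) (≤-reflexive (cong (_+_ (2 ^ s)) (sym (+-identityʳ (2 ^ s)))))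
  square : suc u * suc u ≡ (K + suc s * J) + (4 + 3 * K + 5 * J + (K + 2 * J) * K)
  square = solve 2 (λ K J → let u = con 1 :+ (K :+ con 2 :* J) in
    (con 1 :+ u) :* (con 1 :+ u) := (K :+ (con 1 :+ (u :+ u)) :* J) :+ (con 4 :+ con 3 :* K :+ con 5 :* J :+ (K :+ con 2 :* J) :* K)) refl K J
  exponent≤ : K + suc s * J ≤ 2 ^ s
  exponent≤ = begin
    K + suc s * J      ≤⟨ m≤m+n _ _ ⟩
    _                  ≡⟨ square ⟨
    suc u * suc u      ≤⟨ *-mono-≤ (n<2^n u) (n<2^n u) ⟩
    2 ^ u * 2 ^ u      ≡⟨ ^-distribˡ-+-* 2 u u ⟨
    2 ^ s              ∎

binomSum-negligible : ∀ K J → ∃ λ t₀ → ∀ t → t₀ ≤ t → K * binomSum (suc J) t < 2 ^ t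
binomSum-negligible K J = t₀ , bound
  where
  open ≤-Reasoning
  B = binomSum (suc J)
  t₀ = proj₁ (polynomial<exponential K J)
  bound : ∀ t → t₀ ≤ t → K * B t < 2 ^ t
  bound t t₀≤t = *-cancelʳ-< _ (K * B t) (2 ^ t) (begin-strict
    K * B t * 2 ^ t₀       ≡⟨ *-assoc K (B t) _ ⟩
    K * (B t * 2 ^ t₀)     ≤⟨ *-monoʳ-≤ K (sub-doubling⇒ratio-antitone B (binomSum-suc-≤ (suc J)) t₀≤t) ⟩
    K * (B t₀ * 2 ^ t)     ≡⟨ *-assoc K (B t₀) _ ⟨
    K * B t₀ * 2 ^ t       ≤⟨ *-monoˡ-≤ (2 ^ t) (*-monoʳ-≤ K (binomSum-≤-^ J t₀)) ⟩
    K * suc t₀ ^ J * 2 ^ t <⟨ *-monoˡ-< (2 ^ t) {{m^n≢0 2 t}} (proj₂ (polynomial<exponential K J)) ⟩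
    2 ^ t₀ * 2 ^ t         ≡⟨ *-comm (2 ^ t₀) _ ⟩
    2 ^ t * 2 ^ t₀         ∎)

falling-*-! : ∀ ℓ k → k ≤ ℓ → falling ℓ k * (ℓ ∸ k) ! ≡ ℓ !
falling-*-! ℓ zero    _   = +-identityʳ (ℓ !)
falling-*-! ℓ (suc k) k<ℓ = begin
  falling ℓ k * (ℓ ∸ k) * (ℓ ∸ suc k) !   ≡⟨ *-assoc (falling ℓ k) _ _ ⟩
  falling ℓ k * ((ℓ ∸ k) * (ℓ ∸ suc k) !) ≡⟨ cong (λ x → falling ℓ k * (x * (ℓ ∸ suc k) !)) ℓ∸k≡1+ℓ∸[1+k] ⟩
  falling ℓ k * (suc (ℓ ∸ suc k)) !       ≡⟨ cong (λ x → falling ℓ k * x !) ℓ∸k≡1+ℓ∸[1+k] ⟨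
  falling ℓ k * (ℓ ∸ k) !                 ≡⟨ falling-*-! ℓ k (<⇒≤ k<ℓ) ⟩
  ℓ !                                     ∎
  where
  open ≡-Reasoning
  ℓ∸k≡1+ℓ∸[1+k] : ℓ ∸ k ≡ suc (ℓ ∸ suc k)
  ℓ∸k≡1+ℓ∸[1+k] = +-∸-assoc 1 k<ℓ

falling-vanishes : ∀ ℓ k → ℓ < k → falling ℓ k ≡ 0
falling-vanishes ℓ (suc k) (s≤s ℓ≤k) with m≤n⇒m<n∨m≡n ℓ≤k
... | inj₁ ℓ<k = cong (_* (ℓ ∸ k)) (falling-vanishes ℓ k ℓ<k)
... | inj₂ refl = trans (cong (falling ℓ ℓ *_) (n∸n≡0 ℓ)) (*-zeroʳ (falling ℓ ℓ))

C-*-!-*-! : ∀ n k → k ≤ n → (n C k) * (k ! * (n ∸ k) !) ≡ n !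
C-*-!-*-! n k k≤n = trans (cong (_* (k ! * (n ∸ k) !)) (nCk≡n!/k![n-k]! k≤n))
                          (DivMod.m/n*n≡m {{k !* (n ∸ k) !≢0}} (k![n∸k]!∣n! k≤n))

-- Both sides equal (r + ℓ)! / (ℓ − k)! when k ≤ ℓ, and vanish otherwise.
!-*-C-*-falling : ∀ r ℓ k → r ! * ((r + ℓ) C ℓ) * falling ℓ k ≡ (r + k) ! * ((r + ℓ) C (r + k))
!-*-C-*-falling r ℓ k with ≤-<-connex k ℓ
... | inj₂ ℓ<k = begin
  r ! * ((r + ℓ) C ℓ) * falling ℓ k  ≡⟨ cong (r ! * ((r + ℓ) C ℓ) *_) (falling-vanishes ℓ k ℓ<k) ⟩
  r ! * ((r + ℓ) C ℓ) * 0            ≡⟨ *-zeroʳ (r ! * ((r + ℓ) C ℓ)) ⟩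
  0                                ≡⟨ *-zeroʳ ((r + k) !) ⟨
  (r + k) ! * 0                    ≡⟨ cong ((r + k) ! *_) (k>n⇒nCk≡0 (+-monoʳ-< r ℓ<k)) ⟨
  (r + k) ! * ((r + ℓ) C (r + k))    ∎
  where open ≡-Reasoning
... | inj₁ k≤ℓ = *-cancelʳ-≡ _ _ ((ℓ ∸ k) !) {{(ℓ ∸ k) !≢0}} (trans lhs (sym rhs))
  where
  open ≡-Reasoning
  lhs : r ! * ((r + ℓ) C ℓ) * falling ℓ k * (ℓ ∸ k) ! ≡ (r + ℓ) !
  lhs = begin
    r ! * ((r + ℓ) C ℓ) * falling ℓ k * (ℓ ∸ k) !   ≡⟨ *-assoc (r ! * ((r + ℓ) C ℓ)) _ _ ⟩
    r ! * ((r + ℓ) C ℓ) * (falling ℓ k * (ℓ ∸ k) !) ≡⟨ cong (r ! * ((r + ℓ) C ℓ) *_) (falling-*-! ℓ k k≤ℓ) ⟩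
    r ! * ((r + ℓ) C ℓ) * ℓ !                       ≡⟨ solve 3 (λ a b c → a :* b :* c := b :* (c :* a)) refl (r !) (((r + ℓ) C ℓ)) (ℓ !) ⟩
    ((r + ℓ) C ℓ) * (ℓ ! * r !)                     ≡⟨ cong (λ x → ((r + ℓ) C ℓ) * (ℓ ! * x !)) (m+n∸n≡m r ℓ) ⟨
    ((r + ℓ) C ℓ) * (ℓ ! * (r + ℓ ∸ ℓ) !)           ≡⟨ C-*-!-*-! (r + ℓ) ℓ (m≤n+m ℓ r) ⟩
    (r + ℓ) !                                     ∎
  rhs : (r + k) ! * ((r + ℓ) C (r + k)) * (ℓ ∸ k) ! ≡ (r + ℓ) !
  rhs = begin
    (r + k) ! * ((r + ℓ) C (r + k)) * (ℓ ∸ k) !             ≡⟨ solve 3 (λ a b c → a :* b :* c := b :* (a :* c)) refl ((r + k) !) (((r + ℓ) C (r + k))) ((ℓ ∸ k) !) ⟩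
    ((r + ℓ) C (r + k)) * ((r + k) ! * (ℓ ∸ k) !)           ≡⟨ cong (λ x → ((r + ℓ) C (r + k)) * ((r + k) ! * x !)) ([m+n]∸[m+o]≡n∸o r ℓ k) ⟨
    ((r + ℓ) C (r + k)) * ((r + k) ! * (r + ℓ ∸ (r + k)) !) ≡⟨ C-*-!-*-! (r + ℓ) (r + k) (+-monoʳ-≤ r k≤ℓ) ⟩
    (r + ℓ) !                                             ∎

toℚᵘ-+/suc : ∀ a d → toℚᵘ ((+ a) / suc d) ℚᵘ.≃ mkℚᵘ (+ a) d
toℚᵘ-+/suc a d = ℚ.toℚᵘ-fromℚᵘ (mkℚᵘ (+ a) d)

mkℚᵘ-≃-ℕ : ∀ a b d e → a * suc e ≡ b * suc d → mkℚᵘ (+ a) d ℚᵘ.≃ mkℚᵘ (+ b) e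
mkℚᵘ-≃-ℕ a b d e eq = *≡* (trans (sym (ℤ.pos-* a (suc e))) (trans (cong +_ eq) (ℤ.pos-* b (suc d))))

a/d+c/2d≡[2a+c]/2d : ∀ a c d .{{_ : NonZero d}} .{{_ : NonZero (2 * d)}} →
                     (+ a) / d ℚ.+ (+ c) / (2 * d) ≡ (+ (2 * a + c)) / (2 * d)
a/d+c/2d≡[2a+c]/2d a c (suc d) = ℚ.toℚᵘ-injective (begin
  toℚᵘ ((+ a) / suc d ℚ.+ (+ c) / (2 * suc d))
    ≈⟨ ℚ.toℚᵘ-homo-+ ((+ a) / suc d) ((+ c) / (2 * suc d)) ⟩
  toℚᵘ ((+ a) / suc d) ℚᵘ.+ toℚᵘ ((+ c) / (2 * suc d))
    ≈⟨ ℚᵘ.+-cong (toℚᵘ-+/suc a d) (toℚᵘ-+/suc c d₂) ⟩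
  mkℚᵘ (+ a) d ℚᵘ.+ mkℚᵘ (+ c) d₂
    ≡⟨ cong (λ z → mkℚᵘ z (d₂ + d * suc d₂)) (sym (trans (ℤ.pos-+ (a * suc d₂) (c * suc d))
         (cong₂ ℤ._+_ (ℤ.pos-* a (suc d₂)) (ℤ.pos-* c (suc d))))) ⟩
  mkℚᵘ (+ (a * suc d₂ + c * suc d)) (d₂ + d * suc d₂)
    ≈⟨ mkℚᵘ-≃-ℕ _ _ _ _ (solve 3 (λ a c d → (a :* (con 2 :* d) :+ c :* d) :* (con 2 :* d)
                                          := (con 2 :* a :+ c) :* (d :* (con 2 :* d))) refl a c (suc d)) ⟩
  mkℚᵘ (+ (2 * a + c)) d₂
    ≈⟨ toℚᵘ-+/suc (2 * a + c) d₂ ⟨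
  toℚᵘ ((+ (2 * a + c)) / (2 * suc d)) ∎)
  where
  open import Relation.Binary.Reasoning.Setoid ℚᵘ.≃-setoid
  d₂ = pred (2 * suc d)

[a-bD]D≡-eD : ∀ a b e D → b ℤ.* D ≡ a ℤ.+ e → (a ℤ.* + 1 ℤ.+ ℤ.- b ℤ.* D) ℤ.* D ≡ ℤ.- e ℤ.* D
[a-bD]D≡-eD a b e D bD≡a+e = begin
  (a ℤ.* + 1 ℤ.+ ℤ.- b ℤ.* D) ℤ.* D
    ≡⟨ solveℤ 3 (λ a b D → (a ⊗ κ (+ 1) ⊕ ⊝ b ⊗ D) ⊗ D ⊜ (a ⊕ ⊝ (b ⊗ D)) ⊗ D) refl a b D ⟩
  (a ℤ.+ ℤ.- (b ℤ.* D)) ℤ.* D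
    ≡⟨ cong (λ q → (a ℤ.+ ℤ.- q) ℤ.* D) bD≡a+e ⟩
  (a ℤ.+ ℤ.- (a ℤ.+ e)) ℤ.* D
    ≡⟨ solveℤ 3 (λ a e D → (a ⊕ ⊝ (a ⊕ e)) ⊗ D ⊜ ⊝ e ⊗ D) refl a e D ⟩
  ℤ.- e ℤ.* D ∎
  where
  open ≡-Reasoning
  open ℤ-Solver.+-*-Solver using ()
    renaming (solve to solveℤ; _:+_ to _⊕_; _:*_ to _⊗_; :-_ to ⊝_; _:=_ to _⊜_; con to κ)

toℚᵘ-∣a/d-b∣ : ∀ a e b d → b * suc d ≡ a + e → toℚᵘ (ℚ.∣ (+ a) / suc d ℚ.- (+ b) / 1 ∣) ℚᵘ.≃ mkℚᵘ (+ e) d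
toℚᵘ-∣a/d-b∣ a e b d b[1+d]≡a+e = begin
  toℚᵘ (ℚ.∣ x ∣)
    ≈⟨ ℚ.toℚᵘ-homo-∣-∣ x ⟩
  ℚᵘ.∣ toℚᵘ x ∣
    ≈⟨ ℚᵘ.∣-∣-cong (begin
      toℚᵘ x
        ≈⟨ ℚ.toℚᵘ-homo-+ ((+ a) / suc d) (ℚ.- ((+ b) / 1)) ⟩
      toℚᵘ ((+ a) / suc d) ℚᵘ.+ toℚᵘ (ℚ.- ((+ b) / 1))
        ≈⟨ ℚᵘ.+-cong (toℚᵘ-+/suc a d) (ℚᵘ.≃-trans (ℚ.toℚᵘ-homo‿- ((+ b) / 1)) (ℚᵘ.-‿cong (toℚᵘ-+/suc b 0))) ⟩
      mkℚᵘ (+ a) d ℚᵘ.+ mkℚᵘ (ℤ.- (+ b)) 0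
        ≈⟨ *≡* cross ⟩
      mkℚᵘ (ℤ.- (+ e)) d ∎) ⟩
  mkℚᵘ (+ ℤ.∣ ℤ.- (+ e) ∣) d
    ≡⟨ cong (λ q → mkℚᵘ (+ q) d) (ℤ.∣-i∣≡∣i∣ (+ e)) ⟩
  mkℚᵘ (+ e) d ∎
  where
  open import Relation.Binary.Reasoning.Setoid ℚᵘ.≃-setoid
  x = (+ a) / suc d ℚ.- (+ b) / 1
  cross : (+ a ℤ.* + 1 ℤ.+ ℤ.- (+ b) ℤ.* + suc d) ℤ.* + suc d ≡ ℤ.- (+ e) ℤ.* + suc (d * 1)
  cross = trans ([a-bD]D≡-eD (+ a) (+ b) (+ e) (+ suc d)
                   (trans (sym (ℤ.pos-* b (suc d))) (trans (cong +_ b[1+d]≡a+e) (ℤ.pos-+ a e))))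
                (cong (λ q → ℤ.- (+ e) ℤ.* + suc q) (sym (*-identityʳ d)))

e/d<ε : ∀ e d (ε : ℚ) → ℚ.0ℚ ℚ.< ε → ℚ.↧ₙ ε * e < suc d → mkℚᵘ (+ e) d ℚᵘ.< toℚᵘ ε
e/d<ε e d (mkℚ (+ 0)       _ _) (ℚ.*<* (+<+ ()))
e/d<ε e d (mkℚ ℤ.-[1+ _ ]  _ _) (ℚ.*<* ())
e/d<ε e d (mkℚ (+ suc p) den _) _ ↧ε*e<1+d = *<* (subst₂ ℤ._<_ (ℤ.pos-* e (suc den)) (ℤ.pos-* (suc p) (suc d)) (+<+ (begin-strict
  e * suc den   ≡⟨ *-comm e (suc den) ⟩
  suc den * e   <⟨ ↧ε*e<1+d ⟩
  suc d         ≤⟨ m≤n*m (suc d) (suc p) ⟩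
  suc p * suc d ∎)))
  where open ≤-Reasoning

∣a/d-b∣<ε : ∀ a e b d .{{_ : NonZero d}} (ε : ℚ) → b * d ≡ a + e → ℚ.0ℚ ℚ.< ε → ℚ.↧ₙ ε * e < d →
            ℚ.∣ (+ a) / d ℚ.- (+ b) / 1 ∣ ℚ.< ε
∣a/d-b∣<ε a e b (suc d) ε bd≡a+e 0<ε ↧ε*e<d =
  ℚ.toℚᵘ-cancel-< (ℚᵘ.<-respˡ-≃ (ℚᵘ.≃-sym (toℚᵘ-∣a/d-b∣ a e b d bd≡a+e)) (e/d<ε e d ε 0<ε ↧ε*e<d))

module Series (n r : ℕ) (L : ℕ → ℕ) where

  weight : ℕ → ℕ
  weight k = L k * (r + k) !

  total : ℕ
  total = sumℕ (suc n) weight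

  -- The numerator of summand n r L ℓ, whose denominator is 2 ^ (r + 1 + ℓ).
  coefficient : ℕ → ℕ
  coefficient ℓ = r ! * ((r + ℓ) C ℓ) * sumℕ (suc n) (λ k → L k * falling ℓ k)

  -- The numerator of the M-th partial sum over the denominator 2 ^ (r + M).
  numerator : ℕ → ℕ
  numerator zero    = 0
  numerator (suc M) = 2 * numerator M + coefficient M

  error : ℕ → ℕ
  error M = sumℕ (suc n) (λ k → weight k * binomSum (suc (r + k)) (r + M))

  coefficient-≡ : ∀ ℓ → coefficient ℓ ≡ sumℕ (suc n) (λ k → weight k * ((r + ℓ) C (r + k)))
  coefficient-≡ ℓ = trans (*-distribˡ-sumℕ (suc n) (r ! * ((r + ℓ) C ℓ)) (λ k → L k * falling ℓ k))
    (sumℕ-cong (suc n) λ k → begin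
      r ! * ((r + ℓ) C ℓ) * (L k * falling ℓ k)  ≡⟨ solve 3 (λ a b c → a :* (b :* c) := b :* (a :* c)) refl (r ! * ((r + ℓ) C ℓ)) (L k) (falling ℓ k) ⟩
      L k * (r ! * ((r + ℓ) C ℓ) * falling ℓ k)  ≡⟨ cong (L k *_) (!-*-C-*-falling r ℓ k) ⟩
      L k * ((r + k) ! * ((r + ℓ) C (r + k)))    ≡⟨ *-assoc (L k) _ _ ⟨
      weight k * ((r + ℓ) C (r + k))             ∎)
    where open ≡-Reasoning

  numerator-≡ : ∀ M → numerator M ≡ sumℕ (suc n) (λ k → weight k * scaledBinomSeries (r + k) (r + M))
  numerator-≡ zero = sym (trans (sumℕ-cong (suc n) vanishes) (sumℕ-zero (suc n)))
    where
    vanishes : ∀ k → weight k * scaledBinomSeries (r + k) (r + 0) ≡ 0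
    vanishes k = trans (cong (weight k *_) (scaledBinomSeries-vanishes (r + k) (r + 0)
                         (≤-trans (≤-reflexive (+-identityʳ r)) (m≤m+n r k))))
                       (*-zeroʳ (weight k))
  numerator-≡ (suc M) = sym (begin
    sumℕ (suc n) (λ k → weight k * scaledBinomSeries (r + k) (r + suc M))
      ≡⟨ sumℕ-cong (suc n) (λ k → cong (λ t → weight k * scaledBinomSeries (r + k) t) (+-suc r M)) ⟩
    sumℕ (suc n) (λ k → weight k * (2 * scaledBinomSeries (r + k) (r + M) + (r + M) C (r + k)))
      ≡⟨ sumℕ-cong (suc n) (λ k → *-distribˡ-+ (weight k) _ _) ⟩
    sumℕ (suc n) (λ k → weight k * (2 * scaledBinomSeries (r + k) (r + M)) + weight k * ((r + M) C (r + k)))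
      ≡⟨ sumℕ-+ (suc n) _ _ ⟩
    sumℕ (suc n) (λ k → weight k * (2 * scaledBinomSeries (r + k) (r + M))) + sumℕ (suc n) (λ k → weight k * ((r + M) C (r + k)))
      ≡⟨ cong₂ _+_ (trans (sumℕ-cong (suc n) (λ k → solve 2 (λ a b → a :* (con 2 :* b) := con 2 :* (a :* b)) refl (weight k) (scaledBinomSeries (r + k) (r + M))))
                          (sym (*-distribˡ-sumℕ (suc n) 2 _)))
                   (sym (coefficient-≡ M)) ⟩
    2 * sumℕ (suc n) (λ k → weight k * scaledBinomSeries (r + k) (r + M)) + coefficient M
      ≡⟨ cong (λ x → 2 * x + coefficient M) (numerator-≡ M) ⟨
    numerator (suc M) ∎)
    where open ≡-Reasoning

  total*2^≡numerator+error : ∀ M → total * 2 ^ (r + M) ≡ numerator M + error M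
  total*2^≡numerator+error M = begin
    total * 2 ^ (r + M)
      ≡⟨ *-comm total _ ⟩
    2 ^ (r + M) * total
      ≡⟨ *-distribˡ-sumℕ (suc n) (2 ^ (r + M)) weight ⟩
    sumℕ (suc n) (λ k → 2 ^ (r + M) * weight k)
      ≡⟨ sumℕ-cong (suc n) (λ k → trans (*-comm _ (weight k)) (cong (weight k *_) (sym (scaledBinomSeries-+-binomSum (r + k) (r + M))))) ⟩
    sumℕ (suc n) (λ k → weight k * (scaledBinomSeries (r + k) (r + M) + binomSum (suc (r + k)) (r + M)))
      ≡⟨ sumℕ-cong (suc n) (λ k → *-distribˡ-+ (weight k) _ _) ⟩
    sumℕ (suc n) (λ k → weight k * scaledBinomSeries (r + k) (r + M) + weight k * binomSum (suc (r + k)) (r + M))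
      ≡⟨ sumℕ-+ (suc n) _ _ ⟩
    sumℕ (suc n) (λ k → weight k * scaledBinomSeries (r + k) (r + M)) + error M
      ≡⟨ cong (_+ error M) (numerator-≡ M) ⟨
    numerator M + error M ∎
    where open ≡-Reasoning

  error-≤ : ∀ M → error M ≤ total * binomSum (suc (r + n)) (r + M)
  error-≤ M = begin
    error M
      ≤⟨ sumℕ-mono-≤ (suc n) (λ k k≤n → *-monoʳ-≤ (weight k)
           (sumℕ-monoˡ-≤ ((r + M) C_) (s≤s (+-monoʳ-≤ r (≤-pred k≤n))))) ⟩
    sumℕ (suc n) (λ k → weight k * binomSum (suc (r + n)) (r + M))
      ≡⟨ sumℕ-cong (suc n) (λ k → *-comm (weight k) _) ⟩
    sumℕ (suc n) (λ k → binomSum (suc (r + n)) (r + M) * weight k)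
      ≡⟨ *-distribˡ-sumℕ (suc n) (binomSum (suc (r + n)) (r + M)) weight ⟨
    binomSum (suc (r + n)) (r + M) * total
      ≡⟨ *-comm _ total ⟩
    total * binomSum (suc (r + n)) (r + M) ∎
    where open ≤-Reasoning

  error-negligible : ∀ K → ∃ λ N → ∀ M → N ≤ M → K * error M < 2 ^ (r + M)
  error-negligible K = M₀ , λ M M₀≤M → begin-strict
    K * error M                                 ≤⟨ *-monoʳ-≤ K (error-≤ M) ⟩
    K * (total * binomSum (suc (r + n)) (r + M)) ≡⟨ *-assoc K total _ ⟨
    K * total * binomSum (suc (r + n)) (r + M)   <⟨ proj₂ negligible (r + M) (≤-trans M₀≤M (m≤n+m M r)) ⟩
    2 ^ (r + M)                                 ∎
    where
    open ≤-Reasoning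
    negligible = binomSum-negligible (K * total) (r + n)
    M₀ = proj₁ negligible

  dyadic : ℕ → ℕ → ℚ
  dyadic a e = ((+ a) / 2 ^ e) {{m^n≢0 2 e}}

  partialSum-≡ : ∀ M → sumℚ M (summand n r L) ≡ dyadic (numerator M) (r + M)
  partialSum-≡ zero    = sym (ℚ.0/n≡0 (2 ^ (r + 0)) {{m^n≢0 2 (r + 0)}})
  partialSum-≡ (suc M) = begin
    sumℚ M (summand n r L) ℚ.+ summand n r L M
      ≡⟨ cong (ℚ._+ summand n r L M) (partialSum-≡ M) ⟩
    dyadic (numerator M) (r + M) ℚ.+ dyadic (coefficient M) (suc (r + M))
      ≡⟨ a/d+c/2d≡[2a+c]/2d (numerator M) (coefficient M) (2 ^ (r + M)) {{m^n≢0 2 (r + M)}} {{m^n≢0 2 (suc (r + M))}} ⟩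
    dyadic (numerator (suc M)) (suc (r + M))
      ≡⟨ cong (dyadic (numerator (suc M))) (+-suc r M) ⟨
    dyadic (numerator (suc M)) (r + suc M) ∎
    where open ≡-Reasoning

  partialSums-converge : ConvergesTo (λ M → sumℚ M (summand n r L)) ((+ total) / 1)
  partialSums-converge ε 0<ε = N , λ M N≤M →
    subst (λ q → ℚ.∣ q ℚ.- (+ total) / 1 ∣ ℚ.< ε) (sym (partialSum-≡ M))
      (∣a/d-b∣<ε (numerator M) (error M) total (2 ^ (r + M)) {{m^n≢0 2 (r + M)}} ε
        (total*2^≡numerator+error M) 0<ε (small M N≤M))
    where
    N = proj₁ (error-negligible (ℚ.↧ₙ ε))
    small = proj₂ (error-negligible (ℚ.↧ₙ ε))

-- Encoding a sequence by its sorted version and an insertion code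

toList-insertAt-↭ : ∀ {A : Set} {m} (w : Vec A m) i b → toList (insertAt w i b) ↭ b ∷ toList w
toList-insertAt-↭ w       zero    b = ↭-refl
toList-insertAt-↭ (x ∷ w) (suc i) b = ↭-trans (prep x (toList-insertAt-↭ w i b)) (swap x b ↭-refl)

-- Insertion codes: for each i ≤ m, a position among i slots.
Code : ℕ → Set
Code zero    = ⊤
Code (suc m) = Code m × Fin (suc m)

module Encoding {B : Set} (key : B → ℕ) where

  Sorted : ∀ {m} → Vec B m → Set
  Sorted = AllPairs (λ x y → key x < key y)

  Distinct : ∀ {m} → Vec B m → Set
  Distinct = AllPairs (λ x y → key x ≢ key y)

  decode : ∀ {m} → Vec B m → Code m → Vec B m
  decode []       tt      = []
  decode (b ∷ bs) (c , i) = insertAt (decode bs c) i b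

  toList-decode-↭ : ∀ {m} (v : Vec B m) c → toList (decode v c) ↭ toList v
  toList-decode-↭ []       tt      = ↭-refl
  toList-decode-↭ (b ∷ bs) (c , i) = ↭-trans (toList-insertAt-↭ (decode bs c) i b) (prep b (toList-decode-↭ bs c))

  argmin : ∀ {m} → Vec B (suc m) → Fin (suc m)
  argmin {zero}  (x ∷ []) = zero
  argmin {suc m} (x ∷ xs) = if key x <ᵇ key (lookup xs (argmin xs)) then zero else suc (argmin xs)

  encode : ∀ {m} → Vec B m → Vec B m × Code m
  encode {zero}  []  = [] , tt
  encode {suc m} v   = lookup v p ∷ proj₁ rest , (proj₂ rest , p)
    where
    p = argmin v
    rest = encode (removeAt v p)

  module _ {P : B → Set} where

    All-insertAt : ∀ {m} (w : Vec B m) i {b} → P b → All P w → All P (insertAt w i b)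
    All-insertAt w       zero    pb pw        = pb ∷ pw
    All-insertAt (x ∷ w) (suc i) pb (px ∷ pw) = px ∷ All-insertAt w i pb pw

    All-insertAt⁻ : ∀ {m} (w : Vec B m) i {b} → All P (insertAt w i b) → P b × All P w
    All-insertAt⁻ w       zero    (pb ∷ pw) = pb , pw
    All-insertAt⁻ (x ∷ w) (suc i) (px ∷ p)  = proj₁ (All-insertAt⁻ w i p) , px ∷ proj₂ (All-insertAt⁻ w i p)

    All-lookup-removeAt : ∀ {m} (v : Vec B (suc m)) i → All P v → P (lookup v i) × All P (removeAt v i)
    All-lookup-removeAt v i pv =
      All-insertAt⁻ (removeAt v i) i (subst (All P) (sym (insertAt-removeAt v i)) pv)

    All-decode : ∀ {m} (v : Vec B m) c → All P v → All P (decode v c)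
    All-decode []       tt      []        = []
    All-decode (b ∷ bs) (c , i) (pb ∷ pv) = All-insertAt (decode bs c) i pb (All-decode bs c pv)

    All-encode : ∀ {m} (v : Vec B m) → All P v → All P (proj₁ (encode v))
    All-encode {zero}  []  []  = []
    All-encode {suc m} v   pv  = proj₁ split ∷ All-encode (removeAt v (argmin v)) (proj₂ split)
      where split = All-lookup-removeAt v (argmin v) pv

  decode-encode : ∀ {m} (v : Vec B m) → decode (proj₁ (encode v)) (proj₂ (encode v)) ≡ v
  decode-encode {zero}  []  = refl
  decode-encode {suc m} v   = trans (cong (λ w → insertAt w p (lookup v p)) (decode-encode (removeAt v p)))
                                    (insertAt-removeAt v p)
    where p = argmin v

  argmin-insertAt : ∀ {m} (w : Vec B m) i b → All (λ z → key b < key z) w → argmin (insertAt w i b) ≡ i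
  argmin-insertAt []      zero    b []  = refl
  argmin-insertAt (x ∷ w) zero    b b<w
    with key b <ᵇ key (lookup (x ∷ w) (argmin (x ∷ w)))
       | <ᵇ-reflects-< (key b) (key (lookup (x ∷ w) (argmin (x ∷ w))))
  ... | false | ofⁿ b≮y = ⊥-elim (b≮y (proj₁ (All-lookup-removeAt (x ∷ w) (argmin (x ∷ w)) b<w)))
  ... | true | ofʸ _ = refl
  argmin-insertAt (x ∷ w) (suc i) b (b<x ∷ b<w)
    rewrite argmin-insertAt w i b b<w | insertAt-lookup w i b
    with key x <ᵇ key b | <ᵇ-reflects-< (key x) (key b)
  ... | true  | ofʸ x<b = ⊥-elim (<-asym b<x x<b)
  ... | false | ofⁿ _   = refl

  argmin-minimal : ∀ {m} (v : Vec B (suc m)) →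
                   All (λ z → key (lookup v (argmin v)) ≤ key z) (removeAt v (argmin v))
  argmin-minimal {zero}  (x ∷ [])         = []
  argmin-minimal {suc m} (x ∷ xs@(_ ∷ _)) with argmin xs | argmin-minimal xs
  ... | q | y≤rest with key x <ᵇ key (lookup xs q) | <ᵇ-reflects-< (key x) (key (lookup xs q))
  ... | true  | ofʸ x<y = subst (All (λ z → key x ≤ key z)) (insertAt-removeAt xs q)
      (All-insertAt (removeAt xs q) q (<⇒≤ x<y) (All.map (≤-trans (<⇒≤ x<y)) y≤rest))
  ... | false | ofⁿ x≮y = ≮⇒≥ x≮y ∷ y≤rest

  encode-decode : ∀ {m} (v : Vec B m) c → Sorted v → encode (decode v c) ≡ (v , c)
  encode-decode []       tt      []              = refl
  encode-decode (b ∷ bs) (c , i) (b<bs ∷ sorted)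
    rewrite argmin-insertAt (decode bs c) i b (All-decode bs c b<bs)
          | insertAt-lookup (decode bs c) i b
          | removeAt-insertAt (decode bs c) i b
          | encode-decode bs c sorted = refl

  Distinct-insertAt⁻ : ∀ {m} (w : Vec B m) i b → Distinct (insertAt w i b) → All (λ z → key b ≢ key z) w × Distinct w
  Distinct-insertAt⁻ w       zero    b (b≢w ∷ distinct) = b≢w , distinct
  Distinct-insertAt⁻ (x ∷ w) (suc i) b (x≢ ∷ distinct) =
    (λ b≡x → proj₁ (All-insertAt⁻ w i x≢) (sym b≡x)) ∷ proj₁ ih , proj₂ (All-insertAt⁻ w i x≢) ∷ proj₂ ih
    where ih = Distinct-insertAt⁻ w i b distinct

  encode-sorted : ∀ {m} (v : Vec B m) → Distinct v → Sorted (proj₁ (encode v))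
  encode-sorted {zero}  []  [] = []
  encode-sorted {suc m} v   distinct =
    All-encode (removeAt v p) (All.map (uncurry ≤∧≢⇒<) (All.zip (argmin-minimal v , proj₁ split)))
    ∷ encode-sorted (removeAt v p) (proj₂ split)
    where
    p = argmin v
    split = Distinct-insertAt⁻ (removeAt v p) p (lookup v p) (subst Distinct (sym (insertAt-removeAt v p)) distinct)

  Sorted⇒increasing : ∀ {m} (v : Vec B m) → Sorted v → T (strictlyIncreasing (List.map key (toList v)))
  Sorted⇒increasing []          _                  = tt
  Sorted⇒increasing (x ∷ [])     _                  = tt
  Sorted⇒increasing (x ∷ y ∷ v) ((x<y ∷ _) ∷ sorted) = T-∧⁺ (<⇒<ᵇ x<y) (Sorted⇒increasing (y ∷ v) sorted)

  increasing⇒Sorted : ∀ {m} (v : Vec B m) → T (strictlyIncreasing (List.map key (toList v))) → Sorted v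
  increasing⇒Sorted []          _          = []
  increasing⇒Sorted (x ∷ [])     _          = [] ∷ []
  increasing⇒Sorted (x ∷ y ∷ v) increasing with increasing⇒Sorted (y ∷ v) (proj₂ (T-∧⁻ increasing))
  ... | y<v ∷ sorted = (x<y ∷ All.map (<-trans x<y) y<v) ∷ y<v ∷ sorted
    where x<y = <ᵇ⇒< (key x) (key y) (proj₁ (T-∧⁻ increasing))

all-cong : ∀ {A : Set} {p q : A → Bool} xs → (∀ x → p x ≡ q x) → all p xs ≡ all q xs
all-cong []       p≗q = refl
all-cong (x ∷ xs) p≗q = cong₂ _∧_ (p≗q x) (all-cong xs p≗q)

all-↭ : ∀ {A : Set} (p : A → Bool) {xs ys} → xs ↭ ys → all p xs ≡ all p ys
all-↭ p ↭.refl          = refl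
all-↭ p (prep x xs↭ys)  = cong (p x ∧_) (all-↭ p xs↭ys)
all-↭ p (swap {xs = xs} {ys = ys} x y xs↭ys) = begin
  p x ∧ (p y ∧ all p xs) ≡⟨ ∧-assoc (p x) (p y) _ ⟨
  (p x ∧ p y) ∧ all p xs ≡⟨ cong₂ _∧_ (∧-comm (p x) (p y)) (all-↭ p xs↭ys) ⟩
  (p y ∧ p x) ∧ all p ys ≡⟨ ∧-assoc (p y) (p x) _ ⟩
  p y ∧ (p x ∧ all p ys) ∎
  where open ≡-Reasoning
all-↭ p (↭.trans xs↭ys ys↭zs) = trans (all-↭ p xs↭ys) (all-↭ p ys↭zs)

occ-++ : ∀ {N} (x : Fin N) xs ys → occ x (xs ++ ys) ≡ occ x xs + occ x ys
occ-++ x []       ys = refl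
occ-++ x (y ∷ xs) ys with toℕ x ≡ᵇ toℕ y
... | true  = cong suc (occ-++ x xs ys)
... | false = occ-++ x xs ys

occ-concat-↭ : ∀ {N} (x : Fin N) {bs cs} → bs ↭ cs → occ x (concat bs) ≡ occ x (concat cs)
occ-concat-↭ x ↭.refl = refl
occ-concat-↭ x (prep {xs = bs} {ys = cs} b bs↭cs) = begin
  occ x (b ++ concat bs)        ≡⟨ occ-++ x b (concat bs) ⟩
  occ x b + occ x (concat bs)   ≡⟨ cong (_+_ (occ x b)) (occ-concat-↭ x bs↭cs) ⟩
  occ x b + occ x (concat cs)   ≡⟨ occ-++ x b (concat cs) ⟨
  occ x (b ++ concat cs)        ∎
  where open ≡-Reasoning
occ-concat-↭ x (swap {xs = bs} {ys = cs} a b bs↭cs) = begin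
  occ x (a ++ b ++ concat bs)                 ≡⟨ trans (occ-++ x a _) (cong (_+_ (occ x a)) (occ-++ x b _)) ⟩
  occ x a + (occ x b + occ x (concat bs))     ≡⟨ cong (λ o → occ x a + (occ x b + o)) (occ-concat-↭ x bs↭cs) ⟩
  occ x a + (occ x b + occ x (concat cs))     ≡⟨ solve 3 (λ a b c → a :+ (b :+ c) := b :+ (a :+ c)) refl (occ x a) (occ x b) _ ⟩
  occ x b + (occ x a + occ x (concat cs))     ≡⟨ trans (occ-++ x b _) (cong (_+_ (occ x b)) (occ-++ x a _)) ⟨
  occ x (b ++ a ++ concat cs)                 ∎
  where open ≡-Reasoning
occ-concat-↭ x (↭.trans bs↭cs cs↭ds) = trans (occ-concat-↭ x bs↭cs) (occ-concat-↭ x cs↭ds)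

validSeq-↭ : ∀ {N} S r {bs cs : List (List (Fin N))} → bs ↭ cs → validSeq S r bs ≡ validSeq S r cs
validSeq-↭ {N} S r bs↭cs =
  cong₂ _∧_ (all-cong (allFin N) (λ x → cong (_≡ᵇ 1) (occ-concat-↭ x bs↭cs)))
    (cong₂ _∧_ (all-↭ _ bs↭cs) (cong₂ _∧_ (all-↭ _ bs↭cs) (all-↭ _ bs↭cs)))

occ-∈ : ∀ {N} {x : Fin N} {xs} → x ∈ xs → 1 ≤ occ x xs
occ-∈ {x = x} (here refl) with toℕ x ≡ᵇ toℕ x | ≡⇒≡ᵇ (toℕ x) (toℕ x) refl
... | true  | _  = s≤s z≤n
... | false | ()
occ-∈ {x = x} {y ∷ xs} (there x∈xs) with toℕ x ≡ᵇ toℕ y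
... | true  = s≤s z≤n
... | false = occ-∈ x∈xs

minLabel-∈ : ∀ {N} (b : List (Fin N)) → T (not (null b)) → ∃ λ y → y ∈ b × toℕ y ≡ minLabel b
minLabel-∈ (x ∷ [])     _ = x , here refl , sym (m≤n⇒m⊓n≡m (<⇒≤ (toℕ<n x)))
minLabel-∈ (x ∷ y ∷ xs) _ with ⊓-sel (toℕ x) (minLabel (y ∷ xs)) | minLabel-∈ (y ∷ xs) tt
... | inj₁ x≡min   | _                = x , here refl , sym x≡min
... | inj₂ min≡min | z , z∈ , z≡min = z , there z∈ , trans z≡min (sym min≡min)

minLabel-≢ : ∀ {N} (b c : List (Fin N)) → T (not (null b)) → T (not (null c)) →
             (∀ x → x ∈ b → occ x c ≡ 0) → minLabel b ≢ minLabel c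
minLabel-≢ b c b≢[] c≢[] disjoint min≡min with minLabel-∈ b b≢[] | minLabel-∈ c c≢[]
... | x , x∈b , x≡min | y , y∈c , y≡min with toℕ-injective (trans x≡min (trans min≡min (sym y≡min)))
... | refl = 1+n≰n (subst (1 ≤_) (disjoint x x∈b) (occ-∈ y∈c))

minLabels-distinct : ∀ {N m} (v : Vec (List (Fin N)) m) → All (λ b → T (not (null b))) v →
                     (∀ x → occ x (concat (toList v)) ≤ 1) → AllPairs (λ b c → minLabel b ≢ minLabel c) v
minLabels-distinct []      []              _     = []
minLabels-distinct (b ∷ v) (b≢[] ∷ v≢[]) occ≤1 =
  apart v v≢[] absent ∷ minLabels-distinct v v≢[] (λ x → ≤-trans (m≤n+m _ (occ x b)) (occ≤1′ x))
  where
  occ≤1′ : ∀ x → occ x b + occ x (concat (toList v)) ≤ 1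
  occ≤1′ x = subst (_≤ 1) (occ-++ x b _) (occ≤1 x)
  absent : ∀ x → x ∈ b → occ x (concat (toList v)) ≡ 0
  absent x x∈b = n≤0⇒n≡0 (+-cancelˡ-≤ 1 _ _ (≤-trans (+-monoˡ-≤ _ (occ-∈ x∈b)) (occ≤1′ x)))
  apart : ∀ {k} (u : Vec (List (Fin _)) k) → All (λ c → T (not (null c))) u →
          (∀ x → x ∈ b → occ x (concat (toList u)) ≡ 0) → All (λ c → minLabel b ≢ minLabel c) u
  apart []      []              _      = []
  apart (c ∷ u) (c≢[] ∷ u≢[]) absentᵤ =
    minLabel-≢ b c b≢[] c≢[] (λ x x∈b → m+n≡0⇒m≡0 (occ x c) (absent′ x x∈b))
    ∷ apart u u≢[] (λ x x∈b → m+n≡0⇒n≡0 (occ x c) (absent′ x x∈b))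
    where
    absent′ : ∀ x → x ∈ b → occ x c + occ x (concat (toList u)) ≡ 0
    absent′ x x∈b = trans (sym (occ-++ x c _)) (absentᵤ x x∈b)

sumL : ∀ {A : Set} → (A → ℕ) → List A → ℕ
sumL g []       = 0
sumL g (x ∷ xs) = g x + sumL g xs

sumFin : ∀ {N} → (Fin N → ℕ) → ℕ
sumFin {zero}  f = 0
sumFin {suc N} f = f zero + sumFin (λ x → f (suc x))

sumL-++ : ∀ {A : Set} (g : A → ℕ) xs ys → sumL g (xs ++ ys) ≡ sumL g xs + sumL g ys
sumL-++ g []       ys = refl
sumL-++ g (x ∷ xs) ys = trans (cong (_+_ (g x)) (sumL-++ g xs ys)) (sym (+-assoc (g x) _ _))

sumL-concat : ∀ {A : Set} (g : A → ℕ) xss → sumL g (concat xss) ≡ sumL (sumL g) xss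
sumL-concat g []         = refl
sumL-concat g (xs ∷ xss) = trans (sumL-++ g xs (concat xss)) (cong (_+_ (sumL g xs)) (sumL-concat g xss))

sumL-mono-≤ : ∀ {A : Set} (p : A → Bool) {f g : A → ℕ} xs → T (all p xs) → (∀ x → T (p x) → f x ≤ g x) →
              sumL f xs ≤ sumL g xs
sumL-mono-≤ p []       _     f≤g = ≤-refl
sumL-mono-≤ p (x ∷ xs) all-p f≤g = +-mono-≤ (f≤g x (proj₁ p∧)) (sumL-mono-≤ p xs (proj₂ p∧) f≤g)
  where p∧ = T-∧⁻ all-p

length≡sumL : ∀ {A : Set} (xs : List A) → List.length xs ≡ sumL (λ _ → 1) xs
length≡sumL []       = refl
length≡sumL (x ∷ xs) = cong suc (length≡sumL xs)

isSpecial : ∀ {N} → ℕ → Fin N → ℕ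
isSpecial r x = if toℕ x <ᵇ r then 1 else 0

specials≡sumL : ∀ {N} r (xs : List (Fin N)) → specials r xs ≡ sumL (isSpecial r) xs
specials≡sumL r []       = refl
specials≡sumL r (x ∷ xs) with toℕ x <ᵇ r
... | true  = cong suc (specials≡sumL r xs)
... | false = specials≡sumL r xs

sumFin-cong : ∀ {N} {f g : Fin N → ℕ} → (∀ x → f x ≡ g x) → sumFin f ≡ sumFin g
sumFin-cong {zero}  f≗g = refl
sumFin-cong {suc N} f≗g = cong₂ _+_ (f≗g zero) (sumFin-cong (λ x → f≗g (suc x)))

sumFin-+ : ∀ {N} (f g : Fin N → ℕ) → sumFin (λ x → f x + g x) ≡ sumFin f + sumFin g
sumFin-+ {zero}  f g = refl
sumFin-+ {suc N} f g = trans (cong (_+_ (f zero + g zero)) (sumFin-+ (λ x → f (suc x)) (λ x → g (suc x))))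
  (solve 4 (λ a b c d → (a :+ b) :+ (c :+ d) := (a :+ c) :+ (b :+ d)) refl (f zero) (g zero) _ _)

sumFin-zero : ∀ N → sumFin {N} (λ _ → 0) ≡ 0
sumFin-zero zero    = refl
sumFin-zero (suc N) = sumFin-zero N

sumFin-one : ∀ N → sumFin {N} (λ _ → 1) ≡ N
sumFin-one zero    = refl
sumFin-one (suc N) = cong suc (sumFin-one N)

sumFin-isSpecial : ∀ N r → sumFin {N} (isSpecial r) ≡ N ⊓ r
sumFin-isSpecial zero    r       = refl
sumFin-isSpecial (suc N) zero    = sumFin-zero N
sumFin-isSpecial (suc N) (suc r) = cong suc (sumFin-isSpecial N r)

δ : ∀ {N} → Fin N → Fin N → ℕ
δ y x = if toℕ x ≡ᵇ toℕ y then 1 else 0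

sumFin-δ : ∀ {N} (y : Fin N) (g : Fin N → ℕ) → sumFin (λ x → δ y x * g x) ≡ g y
sumFin-δ {suc N} zero    g = trans (cong (_+_ (g zero + 0)) (sumFin-zero N)) (trans (+-identityʳ _) (+-identityʳ _))
sumFin-δ {suc N} (suc y) g = sumFin-δ y (λ x → g (suc x))

occ-∷ : ∀ {N} (x y : Fin N) ys → occ x (y ∷ ys) ≡ δ y x + occ x ys
occ-∷ x y ys with toℕ x ≡ᵇ toℕ y
... | true  = refl
... | false = refl

sumL≡sumFin-occ : ∀ {N} (g : Fin N → ℕ) xs → sumL g xs ≡ sumFin (λ x → occ x xs * g x)
sumL≡sumFin-occ {N} g []       = sym (sumFin-zero N)
sumL≡sumFin-occ     g (y ∷ ys) = sym (begin
  sumFin (λ x → occ x (y ∷ ys) * g x)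
    ≡⟨ sumFin-cong (λ x → trans (cong (_* g x) (occ-∷ x y ys)) (*-distribʳ-+ (g x) (δ y x) (occ x ys))) ⟩
  sumFin (λ x → δ y x * g x + occ x ys * g x)
    ≡⟨ sumFin-+ (λ x → δ y x * g x) (λ x → occ x ys * g x) ⟩
  sumFin (λ x → δ y x * g x) + sumFin (λ x → occ x ys * g x)
    ≡⟨ cong₂ _+_ (sumFin-δ y g) (sym (sumL≡sumFin-occ g ys)) ⟩
  g y + sumL g ys ∎)
  where open ≡-Reasoning

sumL-permutation : ∀ {N} (g : Fin N → ℕ) xs → (∀ x → occ x xs ≡ 1) → sumL g xs ≡ sumFin g
sumL-permutation g xs occ≡1 =
  trans (sumL≡sumFin-occ g xs) (sumFin-cong (λ x → trans (cong (_* g x) (occ≡1 x)) (+-identityʳ (g x))))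

all-∈ : ∀ {A : Set} (p : A → Bool) {x xs} → T (all p xs) → x ∈ xs → T (p x)
all-∈ p all-p (here refl)  = proj₁ (T-∧⁻ all-p)
all-∈ p all-p (there x∈xs) = all-∈ p (proj₂ (T-∧⁻ all-p)) x∈xs

subst-↔ : ∀ {A : Set} (P : A → Set) {x y} → x ≡ y → P x ↔ P y
subst-↔ P refl = ↔-refl

irrelevant-↔ : ∀ {A B : Set} → (∀ (a a′ : A) → a ≡ a′) → (∀ (b b′ : B) → b ≡ b′) → (A → B) → (B → A) → A ↔ B
irrelevant-↔ irrA irrB f g = mk↔ₛ′ f g (λ b → irrB _ b) (λ a → irrA _ a)

Code↔Fin[m!] : ∀ m → Code m ↔ Fin (m !)
Code↔Fin[m!] zero    = mk↔ₛ′ (λ _ → zero) (λ _ → tt) (λ { zero → refl }) (λ { tt → refl })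
Code↔Fin[m!] (suc m) = ↔-trans (Code↔Fin[m!] m ×-↔ ↔-refl)
                       (↔-trans (↔-sym *↔×) (subst-↔ Fin (*-comm (m !) (suc m))))

Σ-Fin-suc↔ : ∀ {m} (P : Fin (suc m) → Set) → Σ (Fin (suc m)) P ↔ (P zero ⊎ Σ (Fin m) (λ k → P (suc k)))
Σ-Fin-suc↔ P = mk↔ₛ′ to from to∘from from∘to
  where
  to : Σ (Fin _) P → P zero ⊎ Σ (Fin _) (λ k → P (suc k))
  to (zero  , p) = inj₁ p
  to (suc k , p) = inj₂ (k , p)
  from : P zero ⊎ Σ (Fin _) (λ k → P (suc k)) → Σ (Fin _) P
  from (inj₁ p)       = zero , p
  from (inj₂ (k , p)) = suc k , p
  to∘from : ∀ y → to (from y) ≡ y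
  to∘from (inj₁ p)       = refl
  to∘from (inj₂ (k , p)) = refl
  from∘to : ∀ x → from (to x) ≡ x
  from∘to (zero  , p) = refl
  from∘to (suc k , p) = refl

Σ-Fin↔Fin-sumFin : ∀ m (f : Fin m → ℕ) → Σ (Fin m) (λ k → Fin (f k)) ↔ Fin (sumFin f)
Σ-Fin↔Fin-sumFin zero    f = mk↔ₛ′ (λ { (() , _) }) (λ ()) (λ ()) (λ { (() , _) })
Σ-Fin↔Fin-sumFin (suc m) f = ↔-trans (Σ-Fin-suc↔ (λ k → Fin (f k)))
  (↔-trans (↔-refl ⊎-↔ Σ-Fin↔Fin-sumFin m (λ k → f (suc k))) (↔-sym +↔⊎))

sumFin-toℕ : ∀ m (h : ℕ → ℕ) → sumFin {m} (λ k → h (toℕ k)) ≡ sumℕ m h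
sumFin-toℕ zero    h = refl
sumFin-toℕ (suc m) h = trans (cong (_+_ (h 0)) (sumFin-toℕ m (λ k → h (suc k)))) (shift m h)
  where
  shift : ∀ m (h : ℕ → ℕ) → h 0 + sumℕ m (λ k → h (suc k)) ≡ sumℕ (suc m) h
  shift zero    h = +-identityʳ (h 0)
  shift (suc m) h = trans (sym (+-assoc (h 0) _ _)) (cong (_+ h (suc m)) (shift m h))

Σℕ↔ΣFin-shifted : ∀ n r (F : ℕ → Set) → (∀ m → F m → r ≤ m × m ≤ n + r) →
                  Σ ℕ F ↔ Σ (Fin (suc n)) (λ k → F (toℕ k + r))
Σℕ↔ΣFin-shifted n r F bounds = mk↔ₛ′ to from to∘from from∘to
  where
  index : ∀ m → F m → Fin (suc n)
  index m x = fromℕ< (s≤s (subst (m ∸ r ≤_) (m+n∸n≡m n r) (∸-monoˡ-≤ r (proj₂ (bounds m x)))))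
  index-+ : ∀ m (x : F m) → m ≡ toℕ (index m x) + r
  index-+ m x = trans (sym (m∸n+n≡m (proj₁ (bounds m x)))) (cong (_+ r) (sym (toℕ-fromℕ< _)))
  to : Σ ℕ F → Σ (Fin (suc n)) (λ k → F (toℕ k + r))
  to (m , x) = index m x , subst F (index-+ m x) x
  from : Σ (Fin (suc n)) (λ k → F (toℕ k + r)) → Σ ℕ F
  from (k , y) = toℕ k + r , y
  from∘to : ∀ x → from (to x) ≡ x
  from∘to (m , x) = lemma (index-+ m x) x
    where
    lemma : ∀ {a a′} (eq : a ≡ a′) (x : F a) → _≡_ {A = Σ ℕ F} (a′ , subst F eq x) (a , x)
    lemma refl x = refl
  to∘from : ∀ y → to (from y) ≡ y
  to∘from (k , y) = lemma (toℕ-injective (trans (toℕ-fromℕ< _) (m+n∸n≡m (toℕ k) r))) (index-+ (toℕ k + r) y) y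
    where
    lemma : ∀ {k k′ : Fin (suc n)} → k′ ≡ k → (eq : toℕ k + r ≡ toℕ k′ + r) (y : F (toℕ k + r)) →
            _≡_ {A = Σ (Fin (suc n)) (λ k → F (toℕ k + r))} (k′ , subst F eq y) (k , y)
    lemma refl refl y = refl

toVec : ∀ {A : Set} (xs : List A) {m} → List.length xs ≡ m → Vec A m
toVec []       {zero}  _  = []
toVec (x ∷ xs) {suc m} eq = x ∷ toVec xs (suc-injective eq)

toList-toVec : ∀ {A : Set} (xs : List A) {m} (eq : List.length xs ≡ m) → toList (toVec xs eq) ≡ xs
toList-toVec []       {zero}  _  = refl
toList-toVec (x ∷ xs) {suc m} eq = cong (x ∷_) (toList-toVec xs (suc-injective eq))

toVec-toList : ∀ {A : Set} {m} (v : Vec A m) (eq : List.length (toList v) ≡ m) → toVec (toList v) eq ≡ v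
toVec-toList []      _  = refl
toVec-toList (x ∷ v) eq = cong (x ∷_) (toVec-toList v (suc-injective eq))

module _ {A : Set} (P : List A → Set) (irrelevant : ∀ {xs} (p q : P xs) → p ≡ q) where

  Σ-List↔Σ-Vec : Σ (List A) P ↔ Σ ℕ (λ m → Σ (Vec A m) (λ v → P (toList v)))
  Σ-List↔Σ-Vec = mk↔ₛ′ to from to∘from from∘to
    where
    to : Σ (List A) P → Σ ℕ (λ m → Σ (Vec A m) (λ v → P (toList v)))
    to (xs , p) = List.length xs , toVec xs refl , subst P (sym (toList-toVec xs refl)) p
    from : Σ ℕ (λ m → Σ (Vec A m) (λ v → P (toList v))) → Σ (List A) P
    from (m , v , p) = toList v , p
    from∘to : ∀ x → from (to x) ≡ x
    from∘to (xs , p) = Σ-≡,≡→≡ (toList-toVec xs refl , irrelevant _ p)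
    Σ-≡ : ∀ {m} {w v : Vec A m} → w ≡ v → ∀ q p → _≡_ {A = Σ ℕ (λ m → Σ (Vec A m) (λ v → P (toList v)))} (m , w , q) (m , v , p)
    Σ-≡ refl q p = cong (λ q → _ , _ , q) (irrelevant q p)
    to∘from : ∀ y → to (from y) ≡ y
    to∘from (m , v , p) = shift (length-toList v) refl _
      where
      shift : ∀ {m′} (m′≡m : m′ ≡ m) (eq : List.length (toList v) ≡ m′) q →
              _≡_ {A = Σ ℕ (λ m → Σ (Vec A m) (λ v → P (toList v)))} (m′ , toVec (toList v) eq , q) (m , v , p)
      shift refl eq q = Σ-≡ (toVec-toList v eq) q p

  Σ-List-length↔Vec : ∀ m → Σ (List A) (λ xs → P xs × List.length xs ≡ m) ↔ Σ (Vec A m) (λ v → P (toList v))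
  Σ-List-length↔Vec m = mk↔ₛ′ to from to∘from from∘to
    where
    to : Σ (List A) (λ xs → P xs × List.length xs ≡ m) → Σ (Vec A m) (λ v → P (toList v))
    to (xs , p , eq) = toVec xs eq , subst P (sym (toList-toVec xs eq)) p
    from : Σ (Vec A m) (λ v → P (toList v)) → Σ (List A) (λ xs → P xs × List.length xs ≡ m)
    from (v , p) = toList v , p , length-toList v
    to∘from : ∀ y → to (from y) ≡ y
    to∘from (v , p) = Σ-≡,≡→≡ (toVec-toList v (length-toList v) , irrelevant _ p)
    from∘to : ∀ x → from (to x) ≡ x
    from∘to (xs , p , eq) = Σ-≡,≡→≡ (toList-toVec xs eq , pair-irrelevant _ (p , eq))
      where
      pair-irrelevant : (a b : P xs × List.length xs ≡ m) → a ≡ b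
      pair-irrelevant (p , e) (q , e′) = cong₂ _,_ (irrelevant p q) (≡-irrelevant e e′)

All-T : ∀ {A : Set} (p : A → Bool) {m} (v : Vec A m) → T (all p (toList v)) → All (λ x → T (p x)) v
All-T p []      _     = []
All-T p (x ∷ v) all-p = proj₁ (T-∧⁻ all-p) ∷ All-T p v (proj₂ (T-∧⁻ all-p))

module Counting (S : ℕ → Bool) (n r : ℕ) where

  Block : Set
  Block = List (Fin (n + r))

  valid : List Block → Bool
  valid = validSeq S r

  increasing : List Block → Bool
  increasing bs = strictlyIncreasing (List.map minLabel bs)

  open Encoding (minLabel {n + r})

  module _ (bs : List Block) (valid-bs : T (valid bs)) where

    validSeq⁻ : T (coversOnce bs) × T (allNonEmpty bs) × T (sizesIn S bs) × T (specialsSeparated r bs)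
    validSeq⁻ with T-∧⁻ {coversOnce bs} valid-bs
    ... | covers , rest with T-∧⁻ {allNonEmpty bs} rest
    ... | nonEmpty , rest′ with T-∧⁻ {sizesIn S bs} rest′
    ... | sizes , separated = covers , nonEmpty , sizes , separated

    covers : ∀ x → occ x (concat bs) ≡ 1
    covers x = ≡ᵇ⇒≡ _ _ (all-∈ (λ x → occ x (concat bs) ≡ᵇ 1) (proj₁ validSeq⁻) (∈-allFin x))

    nonEmpty : T (allNonEmpty bs)
    nonEmpty = proj₁ (proj₂ validSeq⁻)

    separated : T (specialsSeparated r bs)
    separated = proj₂ (proj₂ (proj₂ validSeq⁻))

    -- Each list holds at least one of the n + r labels.
    length≤n+r : List.length bs ≤ n + r
    length≤n+r = begin
      List.length bs                   ≡⟨ length≡sumL bs ⟩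
      sumL (λ _ → 1) bs                ≤⟨ sumL-mono-≤ (λ b → not (null b)) bs nonEmpty (λ { (_ ∷ _) _ → s≤s z≤n }) ⟩
      sumL (sumL (λ _ → 1)) bs         ≡⟨ sumL-concat (λ _ → 1) bs ⟨
      sumL (λ _ → 1) (concat bs)       ≡⟨ sumL-permutation (λ _ → 1) (concat bs) covers ⟩
      sumFin {n + r} (λ _ → 1)         ≡⟨ sumFin-one (n + r) ⟩
      n + r                            ∎
      where open ≤-Reasoning

    -- Each list holds at most one of the r special labels.
    r≤length : r ≤ List.length bs
    r≤length = begin
      r                                ≡⟨ m≥n⇒m⊓n≡n (m≤n+m r n) ⟨
      (n + r) ⊓ r                      ≡⟨ sumFin-isSpecial (n + r) r ⟨
      sumFin {n + r} (isSpecial r)     ≡⟨ sumL-permutation (isSpecial r) (concat bs) covers ⟨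
      sumL (isSpecial r) (concat bs)   ≡⟨ sumL-concat (isSpecial r) bs ⟩
      sumL (sumL (isSpecial r)) bs     ≤⟨ sumL-mono-≤ (λ b → specials r b <ᵇ 2) bs separated at-most-one ⟩
      sumL (λ _ → 1) bs                ≡⟨ length≡sumL bs ⟨
      List.length bs                   ∎
      where
      open ≤-Reasoning
      at-most-one : ∀ b → T (specials r b <ᵇ 2) → sumL (isSpecial r) b ≤ 1
      at-most-one b <2 = subst (_≤ 1) (specials≡sumL r b) (≤-pred (<ᵇ⇒< (specials r b) 2 <2))

  valid⇒Distinct : ∀ {m} (v : Vec Block m) → T (valid (toList v)) → Distinct v
  valid⇒Distinct v valid-v =
    minLabels-distinct v (All-T _ v (nonEmpty (toList v) valid-v)) (λ x → ≤-reflexive (covers (toList v) valid-v x))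

  valid-decode : ∀ {m} (v : Vec Block m) c → valid (toList (decode v c)) ≡ valid (toList v)
  valid-decode v c = validSeq-↭ S r (toList-decode-↭ v c)

  ValidVec : ℕ → Set
  ValidVec m = Σ (Vec Block m) (λ v → T (valid (toList v)))

  SortedValidVec : ℕ → Set
  SortedValidVec m = Σ (Vec Block m) (λ v → T (valid (toList v)) × T (increasing (toList v)))

  ValidVec↔SortedValidVec×Code : ∀ m → ValidVec m ↔ (SortedValidVec m × Code m)
  ValidVec↔SortedValidVec×Code m = mk↔ₛ′ to from to∘from from∘to
    where
    to : ValidVec m → SortedValidVec m × Code m
    to (v , valid-v) = (s , valid-s , Sorted⇒increasing s (encode-sorted v (valid⇒Distinct v valid-v))) , c
      where
      s = proj₁ (encode v)
      c = proj₂ (encode v)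
      valid-s : T (valid (toList s))
      valid-s = subst T (trans (cong (λ w → valid (toList w)) (sym (decode-encode v))) (valid-decode s c)) valid-v
    from : SortedValidVec m × Code m → ValidVec m
    from ((s , valid-s , _) , c) = decode s c , subst T (sym (valid-decode s c)) valid-s
    to∘from : ∀ y → to (from y) ≡ y
    to∘from ((s , valid-s , increasing-s) , c) =
      same (encode (decode s c)) (encode-decode s c (increasing⇒Sorted s increasing-s))
      where
      same : ∀ (e : Vec Block m × Code m) → e ≡ (s , c) →
             ∀ {p : T (valid (toList (proj₁ e))) × T (increasing (toList (proj₁ e)))} →
             ((proj₁ e , p) , proj₂ e) ≡ ((s , valid-s , increasing-s) , c)
      same _ refl = cong (λ p → (s , p) , c) (cong₂ _,_ (T-irrelevant _ _) (T-irrelevant _ _))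
    from∘to : ∀ x → from (to x) ≡ x
    from∘to (v , valid-v) = Σ-≡,≡→≡ (decode-encode v , T-irrelevant _ _)

  SortedValidVec-length : ∀ m → SortedValidVec m × Code m → r ≤ m × m ≤ n + r
  SortedValidVec-length m ((v , valid-v , _) , _) =
    subst (r ≤_) (length-toList v) (r≤length (toList v) valid-v) , subst (_≤ n + r) (length-toList v) (length≤n+r (toList v) valid-v)

  LStruct↔SortedValidVec : ∀ k → LStruct S n r k ↔ SortedValidVec (k + r)
  LStruct↔SortedValidVec k = ↔-trans (Σ-↔ ↔-refl (λ {bs} → LStruct-conditions bs))
    (Σ-List-length↔Vec (λ bs → T (valid bs) × T (increasing bs)) ×-T-irrelevant (k + r))
    where
    ×-T-irrelevant : ∀ {a b} (p q : T a × T b) → p ≡ q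
    ×-T-irrelevant (p , p′) (q , q′) = cong₂ _,_ (T-irrelevant p q) (T-irrelevant p′ q′)
    LStruct-conditions : ∀ bs → T (valid bs ∧ (List.length bs ≡ᵇ k + r) ∧ increasing bs) ↔
                        ((T (valid bs) × T (increasing bs)) × List.length bs ≡ k + r)
    LStruct-conditions bs = irrelevant-↔ T-irrelevant (λ { (p , e) (q , e′) → cong₂ _,_ (×-T-irrelevant p q) (≡-irrelevant e e′) })
      (λ t → let (v , l∧i) = T-∧⁻ t; (l , i) = T-∧⁻ l∧i in (v , i) , ≡ᵇ⇒≡ _ _ l)
      (λ { ((v , i) , l) → T-∧⁺ v (T-∧⁺ (≡⇒≡ᵇ _ _ l) i) })

  DStruct↔Fin : (L : ℕ → ℕ) → (∀ k → k ≤ n → LStruct S n r k ↔ Fin (L k)) →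
                DStruct S n r ↔ Fin (sumFin {suc n} (λ k → L (toℕ k) * (toℕ k + r) !))
  DStruct↔Fin L LStruct↔Fin = begin
    DStruct S n r
      ↔⟨ Σ-List↔Σ-Vec (λ bs → T (valid bs)) T-irrelevant ⟩
    Σ ℕ ValidVec
      ↔⟨ Σ-↔ ↔-refl (ValidVec↔SortedValidVec×Code _) ⟩
    Σ ℕ (λ m → SortedValidVec m × Code m)
      ↔⟨ Σℕ↔ΣFin-shifted n r _ SortedValidVec-length ⟩
    Σ (Fin (suc n)) (λ k → SortedValidVec (toℕ k + r) × Code (toℕ k + r))
      ↔⟨ Σ-↔ ↔-refl (λ {k} → ↔-trans (↔-sym (LStruct↔SortedValidVec (toℕ k))) (LStruct↔Fin (toℕ k) (≤-pred (toℕ<n k)))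
                                 ×-↔ Code↔Fin[m!] (toℕ k + r)) ⟩
    Σ (Fin (suc n)) (λ k → Fin (L (toℕ k)) × Fin ((toℕ k + r) !))
      ↔⟨ Σ-↔ ↔-refl (↔-sym *↔×) ⟩
    Σ (Fin (suc n)) (λ k → Fin (L (toℕ k) * (toℕ k + r) !))
      ↔⟨ Σ-Fin↔Fin-sumFin (suc n) _ ⟩
    Fin (sumFin {suc n} (λ k → L (toℕ k) * (toℕ k + r) !)) ∎
    where open EquationalReasoning

  size-DStruct : (L : ℕ → ℕ) → (∀ k → k ≤ n → LStruct S n r k ↔ Fin (L k)) →
          (D : ℕ) → DStruct S n r ↔ Fin D → D ≡ sumℕ (suc n) (λ k → L k * (r + k) !)
  size-DStruct L LStruct↔Fin D DStruct↔FinD = begin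
    D                                                ≡⟨ ↔⇒≡ (↔-trans (↔-sym DStruct↔FinD) (DStruct↔Fin L LStruct↔Fin)) ⟩
    sumFin {suc n} (λ k → L (toℕ k) * (toℕ k + r) !) ≡⟨ sumFin-toℕ (suc n) (λ k → L k * (k + r) !) ⟩
    sumℕ (suc n) (λ k → L k * (k + r) !)             ≡⟨ sumℕ-cong (suc n) (λ k → cong (λ m → L k * m !) (+-comm k r)) ⟩
    sumℕ (suc n) (λ k → L k * (r + k) !)             ∎
    where open ≡-Reasoning

mainTheorem18 : (S : ℕ → Bool) → S 0 ≡ false → (n r : ℕ)
    → (L : ℕ → ℕ) → (∀ k → k ≤ n → LStruct S n r k ↔ Fin (L k))
    → (D : ℕ) → DStruct S n r ↔ Fin D
    → ConvergesTo (λ M → sumℚ M (summand n r L)) ((+ D) / 1)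
mainTheorem18 S _ n r L LStruct↔Fin D DStruct↔FinD
  rewrite Counting.size-DStruct S n r L LStruct↔Fin D DStruct↔FinD = Series.partialSums-converge n r L
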